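{- For any integers $C\ge 2$, $\rho\ge 1$ and $t\ge 1$ there is a finite simple bipartite graph $G^t=(L\cup R,E)$ whose vertex set is partitioned into nonempty layers $L_1,R_1,L_2,R_2,\ldots,L_t,R_t$ with $L=\bigcup_i L_i$ and $R=\bigcup_i R_i$, such that every edge joins $L_i$ to $R_i$ for some $1\le i\le t$ or joins $R_i$ to $L_{i+1}$ for some $1\le i\le t-1$; for each $1\le i\le t$ the subgraph induced by $L_i\cup R_i$ is $(C,1)$-biregular (every vertex of $L_i$ has degree $C$ and every vertex of $R_i$ has degree $1$ in it); for each $1\le i\le t-1$ the subgraph induced by $R_i\cup L_{i+1}$ is $(1,C)$-biregular (every vertex of $R_i$ has degree $1$ and every vertex of $L_{i+1}$ has degree $C$ in it); and $G^t$ has girth exceeding $2t\rho$.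
   Context: The girth of a graph is the length of its shortest cycle. -}

module Defs where

open import Data.Nat using (ℕ; zero; suc; _+_; _*_; _<_; _≤_; _≡ᵇ_)
open import Data.Bool using (Bool; true; false; _∧_; _∨_; if_then_else_)
open import Data.Fin using (Fin; toℕ; fromℕ; inject₁)
  renaming (zero to fzero; suc to fsuc)
open import Data.List using (List; map; allFin)
open import Data.Nat.ListAction using (sum)
open import Data.Product using (Σ; _×_; ∃-syntax)
open import Data.Empty using (⊥)
open import Data.Sum using (_⊎_)
open import Function.Definitions using (Injective)
open import Relation.Binary.PropositionalEquality using (_≡_)

record Graph (n : ℕ) : Set where
  field
    adj    : Fin n → Fin n → Bool
    sym    : ∀ u v → adj u v ≡ adj v u
    irrefl : ∀ v → adj v v ≡ false
open Graph public

HasCycleOfLength : ∀ {n} → Graph n → ℕ → Set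
HasCycleOfLength {n} G zero = ⊥
HasCycleOfLength {n} G (suc m) =
  3 ≤ suc m ×
  Σ (Fin (suc m) → Fin n) λ f →
    Injective _≡_ _≡_ f ×
    (∀ (j : Fin m) → adj G (f (inject₁ j)) (f (fsuc j)) ≡ true) ×
    adj G (f (fromℕ m)) (f fzero) ≡ true

-- girth(G) > g  :⇔  every cycle of G has length > g (vacuous for forests: girth ∞).
GirthGreaterThan : ∀ {n} → Graph n → ℕ → Set
GirthGreaterThan G g = ∀ k → HasCycleOfLength G k → g < k

-- Number of neighbours of v lying in the vertex set P
-- (= degree of v in the subgraph induced by P, when v ∈ P).
degIn : ∀ {n} → Graph n → Fin n → (Fin n → Bool) → ℕ
degIn {n} G v P = sum (map (λ w → if adj G v w ∧ P w then 1 else 0) (allFin n))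

data Side : Set where
  L R : Side

isL : Side → Bool
isL L = true
isL R = false

isR : Side → Bool
isR L = false
isR R = true

-- Layers are indexed 0-based: layer (s , i) with i : Fin t stands for
-- L_{i+1} (s = L) or R_{i+1} (s = R) of the paper.
-- Allowed edge types: L_i – R_i, and R_i – L_{i+1}.
AllowedEdge : ∀ {t} → Side → Fin t → Side → Fin t → Set
AllowedEdge L i R j = toℕ i ≡ toℕ j
AllowedEdge R i L j = suc (toℕ i) ≡ toℕ j
AllowedEdge L i L j = ⊥
AllowedEdge R i R j = ⊥

record IsLayered {n : ℕ} (C t : ℕ) (G : Graph n)
                 (side : Fin n → Side) (idx : Fin n → Fin t) : Set where
  field
    -- every layer L_i, R_i is nonempty (and the layers partition the vertices,
    -- since each vertex gets exactly one (side , idx))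
    nonempty : ∀ (s : Side) (i : Fin t) → ∃[ v ] (side v ≡ s × idx v ≡ i)
    edges    : ∀ u v → adj G u v ≡ true →
               AllowedEdge (side u) (idx u) (side v) (idx v) ⊎
               AllowedEdge (side v) (idx v) (side u) (idx u)
    blockL   : ∀ v → side v ≡ L →
               degIn G v (λ w → toℕ (idx w) ≡ᵇ toℕ (idx v)) ≡ C
    blockR   : ∀ v → side v ≡ R →
               degIn G v (λ w → toℕ (idx w) ≡ᵇ toℕ (idx v)) ≡ 1
    linkR    : ∀ v → side v ≡ R → suc (toℕ (idx v)) < t →
               degIn G v (λ w → (isR (side w) ∧ (toℕ (idx w) ≡ᵇ toℕ (idx v)))
                              ∨ (isL (side w) ∧ (toℕ (idx w) ≡ᵇ suc (toℕ (idx v))))) ≡ 1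
    linkL    : ∀ v → side v ≡ L → 1 ≤ toℕ (idx v) →
               degIn G v (λ w → (isR (side w) ∧ (suc (toℕ (idx w)) ≡ᵇ toℕ (idx v)))
                              ∨ (isL (side w) ∧ (toℕ (idx w) ≡ᵇ toℕ (idx v)))) ≡ C

module Submission where

-- Start from the layered graph with L_i = {ℓ_i}, R_i = {r_i1, …, r_iC} in which ℓ_i and ℓ_(i+1)
-- are both joined to every r_ik. A covering map preserves the number of neighbours inside any
-- vertex set pulled back from the base, so every covering of a layered graph is layered with the
-- same parameters. It therefore suffices to raise the girth by one with a covering, and the
-- Z₂^(V×V) "homology cover" does this: crossing the edge uv toggles the coordinates (u,v) and
-- (v,u). A cycle of the cover projects to a non-backtracking closed walk of G. If that walk
-- revisits a vertex, it contains a strictly shorter cycle of G; if it is itself a cycle of G,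
-- the coordinate (last, first) is toggled by its closing edge only, so the walk cannot close up
-- in the cover. Iterating 2tρ times gives girth > 2tρ.

open import Defs hiding (sym)
open import Data.Nat using (ℕ; _≤_; _*_)
open import Data.Fin using (Fin)
open import Data.Product using (Σ; ∃-syntax)

import Data.Nat.Properties as ℕ
open import Algebra.Properties.Semiring.Sum ℕ.+-*-semiring
  using (sum; sum-syntax; sum-cong-≗; sum-remove; sum-replicate-zero; *-distribˡ-sum)
open import Data.Bool using (Bool; true; false; _∧_; _∨_; if_then_else_)
open import Data.Bool.Properties
  using (T-∨; T-≡; ∨-zeroʳ; ∨-identityʳ; ∧-conicalˡ; ∧-conicalʳ; ∧-zeroʳ; ∧-identityʳ)
open import Data.Empty using (⊥; ⊥-elim)
open import Data.Fin
  using (toℕ; pred; fromℕ; fromℕ<; inject₁; combine; remQuot; opposite; _↑ˡ_; _↑ʳ_)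
  renaming (zero to fzero; suc to fsuc)
open import Data.Fin.Properties
  using ( _≟_; any?; toℕ-injective; toℕ<n; toℕ-fromℕ; toℕ-fromℕ<; toℕ-inject₁; toℕ-inject₁-≢
        ; punchInᵢ≢i; remQuot-combine; combine-remQuot; combine-injective; opposite-involutive)
open import Data.List using (tabulate)
open import Data.List.Properties using (map-tabulate)
open import Data.Nat using (zero; suc; _+_; _∸_; _^_; _<_; _<?_; _≡ᵇ_; s≤s; z≤n; s≤s⁻¹)
import Data.Nat.ListAction as List
open import Data.Product using (∃₂; _×_; _,_; proj₁; proj₂; uncurry)
open import Data.Sum as Sum using (_⊎_; inj₁; inj₂)
open import Data.Vec using (Vec; []; _∷_; lookup; updateAt)
open import Data.Vec.Properties
  using (updateAt-updateAt-local; updateAt-id; lookup∘updateAt; lookup∘updateAt′)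
open import Function using (_∘_; id)
open import Function.Bundles using (_⇔_; mk⇔; Equivalence)
open import Function.Definitions using (Injective)
open import Relation.Binary.PropositionalEquality
  using (_≡_; _≢_; refl; sym; trans; cong; cong₂; subst; module ≡-Reasoning)
open import Relation.Nullary using (¬_; yes; no; does)
open import Relation.Nullary.Decidable using (dec-true; dec-false; does-⇔; _×-dec_)

-- Finite sums and degrees

indicator : Bool → ℕ
indicator b = if b then 1 else 0

count : ∀ {n} → (Fin n → Bool) → ℕ
count p = sum (indicator ∘ p)

sumList-tabulate : ∀ {n} (f : Fin n → ℕ) → List.sum (tabulate f) ≡ sum f
sumList-tabulate {zero}  f = refl
sumList-tabulate {suc n} f = cong (f fzero +_) (sumList-tabulate (f ∘ fsuc))

degIn≡count : ∀ {n} (G : Graph n) v P → degIn G v P ≡ count (λ w → adj G v w ∧ P w)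
degIn≡count {n} G v P =
  trans (cong List.sum (map-tabulate {n = n} id f)) (sumList-tabulate f)
  where
  f : Fin n → ℕ
  f w = indicator (adj G v w ∧ P w)

sum-↑ : ∀ m n (f : Fin (m + n) → ℕ) →
        sum f ≡ ∑[ i < m ] f (i ↑ˡ n) + ∑[ j < n ] f (m ↑ʳ j)
sum-↑ zero    n f = refl
sum-↑ (suc m) n f =
  trans (cong (f fzero +_) (sum-↑ m n (f ∘ fsuc))) (sym (ℕ.+-assoc (f fzero) _ _))

sum-combine : ∀ m n (f : Fin (m * n) → ℕ) →
              sum f ≡ ∑[ i < m ] ∑[ j < n ] f (combine i j)
sum-combine zero    n f = refl
sum-combine (suc m) n f =
  trans (sum-↑ n (m * n) f) (cong (sum (f ∘ (_↑ˡ m * n)) +_) (sum-combine m n (f ∘ (n ↑ʳ_))))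

sum-zero : ∀ {n} (f : Fin n → ℕ) → (∀ i → f i ≡ 0) → sum f ≡ 0
sum-zero {n} f f≡0 = trans (sum-cong-≗ f≡0) (sum-replicate-zero n)

sum-const : ∀ n x → ∑[ _ < n ] x ≡ n * x
sum-const zero    x = refl
sum-const (suc n) x = cong (x +_) (sum-const n x)

sum-pointMass : ∀ {n} (f : Fin n → ℕ) j → (∀ i → i ≢ j → f i ≡ 0) → sum f ≡ f j
sum-pointMass {suc _} f j f≡0 = trans (sum-remove {i = j} f)
  (trans (cong (f j +_) (sum-zero _ (λ i → f≡0 _ (punchInᵢ≢i j i)))) (ℕ.+-identityʳ (f j)))

count-pinned : ∀ {t} (c : Fin t → Bool) (j : Fin t) {m} → toℕ j ≡ m → c j ≡ true →
               count (λ i → c i ∧ (toℕ i ≡ᵇ m)) ≡ 1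
count-pinned c j {m} j≡m cj =
  trans (sum-pointMass _ j elsewhere) (cong indicator (cong₂ _∧_ cj (dec-true (toℕ j ℕ.≟ m) j≡m)))
  where
  elsewhere : ∀ i → i ≢ j → indicator (c i ∧ (toℕ i ≡ᵇ m)) ≡ 0
  elsewhere i i≢j = cong indicator (trans
    (cong (c i ∧_) (dec-false (toℕ i ℕ.≟ m) (λ i≡m → i≢j (toℕ-injective (trans i≡m (sym j≡m))))))
    (∧-zeroʳ (c i)))

-- Walks and cycles

module _ {len n : ℕ} (q : Fin len → Fin n) where

  InjectiveBelow : ℕ → Set
  InjectiveBelow k = ∀ x y → toℕ x < k → toℕ y < k → q x ≡ q y → x ≡ y

  FirstRepetition : Set
  FirstRepetition = ∃₂ λ a b → toℕ a < toℕ b × q a ≡ q b × InjectiveBelow (toℕ b)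

  private
    extend : ∀ z → InjectiveBelow (toℕ z) → InjectiveBelow (suc (toℕ z)) ⊎ FirstRepetition
    extend z inj with any? (λ a → (toℕ a <? toℕ z) ×-dec (q a ≟ q z))
    ... | yes (a , a<z , qa≡qz) = inj₂ (a , z , a<z , qa≡qz , inj)
    ... | no noRepeat = inj₁ inj′
      where
      repeat : ∀ {x y} → toℕ x < toℕ z → toℕ y ≡ toℕ z → q x ≡ q y → ⊥
      repeat {x} x<z y≡z qx≡qy = noRepeat (x , x<z , trans qx≡qy (cong q (toℕ-injective y≡z)))

      inj′ : InjectiveBelow (suc (toℕ z))
      inj′ x y x≤z y≤z qx≡qy with ℕ.m<1+n⇒m<n∨m≡n x≤z | ℕ.m<1+n⇒m<n∨m≡n y≤z
      ... | inj₁ x<z | inj₁ y<z = inj x y x<z y<z qx≡qy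
      ... | inj₁ x<z | inj₂ y≡z = ⊥-elim (repeat x<z y≡z qx≡qy)
      ... | inj₂ x≡z | inj₁ y<z = ⊥-elim (repeat y<z x≡z (sym qx≡qy))
      ... | inj₂ x≡z | inj₂ y≡z = toℕ-injective (trans x≡z (sym y≡z))

  injectiveBelow⊎firstRepetition : ∀ k → k ≤ len → InjectiveBelow k ⊎ FirstRepetition
  injectiveBelow⊎firstRepetition zero    _     = inj₁ (λ _ _ ())
  injectiveBelow⊎firstRepetition (suc k) k<len
    with injectiveBelow⊎firstRepetition k (ℕ.<⇒≤ k<len)
  ... | inj₂ repetition = inj₂ repetition
  ... | inj₁ inj with fromℕ< k<len | toℕ-fromℕ< k<len
  ...   | z | refl = extend z inj

  injective⊎firstRepetition : Injective _≡_ _≡_ q ⊎ FirstRepetition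
  injective⊎firstRepetition with injectiveBelow⊎firstRepetition len ℕ.≤-refl
  ... | inj₁ inj        = inj₁ (λ {x} {y} → inj x y (toℕ<n x) (toℕ<n y))
  ... | inj₂ repetition = inj₂ repetition

constant-along : ∀ {A : Set} {m} (h : Fin (suc m) → A) →
                 (∀ (j : Fin m) → h (fsuc j) ≡ h (inject₁ j)) → ∀ x → h x ≡ h fzero
constant-along {m = zero}  h step fzero    = refl
constant-along {m = suc m} h step fzero    = refl
constant-along {m = suc m} h step (fsuc x) =
  trans (step x) (constant-along (h ∘ inject₁) (step ∘ inject₁) x)

module _ {n : ℕ} (G : Graph n) where

  IsWalk : ∀ {len} → (Fin len → Fin n) → Set
  IsWalk q = ∀ x y → suc (toℕ x) ≡ toℕ y → adj G (q x) (q y) ≡ true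

  IsNonBacktracking : ∀ {len} → (Fin len → Fin n) → Set
  IsNonBacktracking q = ∀ x y → 2 + toℕ x ≡ toℕ y → q x ≢ q y

  cycle-isWalk : ∀ {m} (f : Fin (suc m) → Fin n) →
                 (∀ (j : Fin m) → adj G (f (inject₁ j)) (f (fsuc j)) ≡ true) → IsWalk f
  cycle-isWalk f steps x (fsuc y) 1+x≡1+y
    with refl ← toℕ-injective (trans (toℕ-inject₁ y) (ℕ.suc-injective (sym 1+x≡1+y))) = steps y

  closedSegment⇒cycle : ∀ {len} {q : Fin len → Fin n} → IsWalk q → ∀ k a b →
                        3 + k + toℕ a ≡ toℕ b → q a ≡ q b → InjectiveBelow q (toℕ b) →
                        HasCycleOfLength G (3 + k)
  closedSegment⇒cycle {len} {q} walk k a b d+a≡b qa≡qb inj =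
    s≤s (s≤s (s≤s z≤n)) , g , g-injective , g-steps , g-closes
    where
    below-b : ∀ (i : Fin (3 + k)) → toℕ i + toℕ a < toℕ b
    below-b i = subst (toℕ i + toℕ a <_) d+a≡b (ℕ.+-monoˡ-< (toℕ a) (toℕ<n i))

    index : Fin (3 + k) → Fin len
    index i = fromℕ< (ℕ.<-trans (below-b i) (toℕ<n b))

    toℕ-index : ∀ i → toℕ (index i) ≡ toℕ i + toℕ a
    toℕ-index i = toℕ-fromℕ< _

    g : Fin (3 + k) → Fin n
    g = q ∘ index

    g-injective : Injective _≡_ _≡_ g
    g-injective {i} {j} gi≡gj = toℕ-injective (ℕ.+-cancelʳ-≡ _ (toℕ i) (toℕ j)
      (trans (sym (toℕ-index i)) (trans (cong toℕ same-index) (toℕ-index j))))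
      where
      same-index : index i ≡ index j
      same-index = inj (index i) (index j)
        (subst (_< toℕ b) (sym (toℕ-index i)) (below-b i))
        (subst (_< toℕ b) (sym (toℕ-index j)) (below-b j)) gi≡gj

    g-steps : ∀ (j : Fin (2 + k)) → adj G (g (inject₁ j)) (g (fsuc j)) ≡ true
    g-steps j = walk (index (inject₁ j)) (index (fsuc j))
      (trans (cong suc (trans (toℕ-index (inject₁ j)) (cong (_+ toℕ a) (toℕ-inject₁ j))))
             (sym (toℕ-index (fsuc j))))

    g-closes : adj G (g (fromℕ (2 + k))) (g fzero) ≡ true
    g-closes = subst (λ v → adj G (g (fromℕ (2 + k))) v ≡ true)
      (trans (sym qa≡qb) (cong q (toℕ-injective (sym (toℕ-index fzero)))))
      (walk (index (fromℕ (2 + k))) b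
        (trans (cong suc (trans (toℕ-index _) (cong (_+ toℕ a) (toℕ-fromℕ (2 + k))))) d+a≡b))

  firstRepetition⇒shorterCycle : ∀ {len} {q : Fin len → Fin n} → IsWalk q → IsNonBacktracking q →
                                 FirstRepetition q → ∃[ d ] d < len × HasCycleOfLength G d
  firstRepetition⇒shorterCycle {len} {q} walk nonBacktracking (a , b , a<b , qa≡qb , inj) =
    toℕ b ∸ toℕ a , ℕ.≤-<-trans (ℕ.m∸n≤m (toℕ b) (toℕ a)) (toℕ<n b) ,
    cycleOfGap (toℕ b ∸ toℕ a) (ℕ.m∸n+n≡m (ℕ.<⇒≤ a<b))
    where
    cycleOfGap : ∀ d → d + toℕ a ≡ toℕ b → HasCycleOfLength G d
    cycleOfGap 0 a≡b = ⊥-elim (ℕ.<⇒≢ a<b a≡b)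
    cycleOfGap 1 1+a≡b with () ← trans (sym (irrefl G (q b)))
      (subst (λ v → adj G v (q b) ≡ true) qa≡qb (walk a b 1+a≡b))
    cycleOfGap 2 2+a≡b = ⊥-elim (nonBacktracking a b 2+a≡b qa≡qb)
    cycleOfGap (suc (suc (suc k))) d+a≡b = closedSegment⇒cycle walk k a b d+a≡b qa≡qb inj

-- Bit vectors

-- Vertex sets have to be of the form Fin n, so Z₂^N is represented by Fin (2 ^ N),
-- read as a vector of bits through the mixed-radix bijection combine/remQuot.
Bits : ℕ → Set
Bits N = Fin (2 ^ N)

toVec : ∀ N → Bits N → Vec (Fin 2) N
toVec zero    _ = []
toVec (suc N) s = uncurry (λ b r → b ∷ toVec N r) (remQuot (2 ^ N) s)

fromVec : ∀ {N} → Vec (Fin 2) N → Bits N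
fromVec []      = fzero
fromVec (b ∷ v) = combine b (fromVec v)

toVec-fromVec : ∀ {N} (v : Vec (Fin 2) N) → toVec N (fromVec v) ≡ v
toVec-fromVec []              = refl
toVec-fromVec {suc N} (b ∷ v) =
  trans (cong (uncurry (λ b r → b ∷ toVec N r)) (remQuot-combine b (fromVec v)))
        (cong (b ∷_) (toVec-fromVec v))

fromVec-toVec : ∀ N (s : Bits N) → fromVec (toVec N s) ≡ s
fromVec-toVec zero    fzero = refl
fromVec-toVec (suc N) s     =
  trans (cong (combine {2} b) (fromVec-toVec N r)) (combine-remQuot {2} (2 ^ N) s)
  where
  b : Fin 2
  b = proj₁ (remQuot {2} (2 ^ N) s)
  r : Bits N
  r = proj₂ (remQuot {2} (2 ^ N) s)

flip : ∀ {N} → Fin N → Bits N → Bits N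
flip {N} i s = fromVec (updateAt (toVec N s) i opposite)

bit : ∀ {N} → Fin N → Bits N → Fin 2
bit {N} i s = lookup (toVec N s) i

flip-involutive : ∀ {N} (i : Fin N) s → flip i (flip i s) ≡ s
flip-involutive {N} i s = begin
  fromVec (updateAt (toVec N (flip i s)) i opposite)
    ≡⟨ cong (λ v → fromVec (updateAt v i opposite)) (toVec-fromVec (updateAt (toVec N s) i opposite)) ⟩
  fromVec (updateAt (updateAt (toVec N s) i opposite) i opposite)
    ≡⟨ cong fromVec (updateAt-updateAt-local i (toVec N s) (opposite-involutive _)) ⟩
  fromVec (updateAt (toVec N s) i id)
    ≡⟨ cong fromVec (updateAt-id i (toVec N s)) ⟩
  fromVec (toVec N s)
    ≡⟨ fromVec-toVec N s ⟩
  s ∎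
  where open ≡-Reasoning

bit-flip : ∀ {N} (i : Fin N) s → bit i (flip i s) ≡ opposite (bit i s)
bit-flip {N} i s = trans (cong (λ v → lookup v i) (toVec-fromVec (updateAt (toVec N s) i opposite)))
                         (lookup∘updateAt i (toVec N s))

bit-flip-≢ : ∀ {N} (i j : Fin N) s → i ≢ j → bit i (flip j s) ≡ bit i s
bit-flip-≢ {N} i j s i≢j =
  trans (cong (λ v → lookup v i) (toVec-fromVec (updateAt (toVec N s) j opposite)))
        (lookup∘updateAt′ i j i≢j (toVec N s))

opposite-≢ : ∀ (b : Fin 2) → opposite b ≢ b
opposite-≢ fzero        ()
opposite-≢ (fsuc fzero) ()

-- Coverings

record IsCoveringMap {n n′ : ℕ} (G′ : Graph n′) (G : Graph n) (p : Fin n′ → Fin n) : Set where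
  field
    adj-preserving   : ∀ {x y} → adj G′ x y ≡ true → adj G (p x) (p y) ≡ true
    degIn-preserving : ∀ x (P : Fin n → Bool) → degIn G′ x (P ∘ p) ≡ degIn G (p x) P
    surjective       : ∀ v → ∃[ x ] p x ≡ v

IsLayered-pullback : ∀ {n n′ C t} {G : Graph n} {G′ : Graph n′} {p : Fin n′ → Fin n}
                       {side : Fin n → Side} {idx : Fin n → Fin t} →
                     IsCoveringMap G′ G p → IsLayered C t G side idx →
                     IsLayered C t G′ (side ∘ p) (idx ∘ p)
IsLayered-pullback {p = p} {side} {idx} covering layered = record
  { nonempty = λ s i → let (v , sv , iv) = nonempty s i
                           (x , px≡v)    = surjective v
                       in x , trans (cong side px≡v) sv , trans (cong idx px≡v) iv
  ; edges    = λ x y → edges (p x) (p y) ∘ adj-preserving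
  ; blockL   = λ x sx → trans (degIn-preserving x _) (blockL (p x) sx)
  ; blockR   = λ x sx → trans (degIn-preserving x _) (blockR (p x) sx)
  ; linkR    = λ x sx last → trans (degIn-preserving x _) (linkR (p x) sx last)
  ; linkL    = λ x sx first → trans (degIn-preserving x _) (linkL (p x) sx first)
  }
  where
  open IsCoveringMap covering
  open IsLayered layered

module PermutationLift {n K : ℕ} (G : Graph n) (π : Fin n → Fin n → Fin K → Fin K)
                       (π-inverse : ∀ u v s → π v u (π u v s) ≡ s) where

  project : Fin (n * K) → Fin n
  project x = proj₁ (remQuot {n} K x)

  fibre : Fin (n * K) → Fin K
  fibre x = proj₂ (remQuot {n} K x)

  liftAdj : Fin (n * K) → Fin (n * K) → Bool
  liftAdj x y = adj G (project x) (project y) ∧ does (fibre y ≟ π (project x) (project y) (fibre x))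

  π-transpose : ∀ u v s t → t ≡ π u v s ⇔ s ≡ π v u t
  π-transpose u v s t = mk⇔ (λ t≡ → sym (trans (cong (π v u) t≡) (π-inverse u v s)))
                            (λ s≡ → sym (trans (cong (π u v) s≡) (π-inverse v u t)))

  lift : Graph (n * K)
  lift = record
    { adj    = liftAdj
    ; sym    = λ x y → cong₂ _∧_ (Graph.sym G (project x) (project y))
                         (does-⇔ (π-transpose (project x) (project y) (fibre x) (fibre y))
                                 (fibre y ≟ _) (fibre x ≟ _))
    ; irrefl = λ x → cong (_∧ does (fibre x ≟ π (project x) (project x) (fibre x)))
                          (irrefl G (project x))
    }

  project-combine : ∀ v s → project (combine v s) ≡ v
  project-combine v s = cong proj₁ (remQuot-combine {n} {K} v s)

  project-fibre-injective : ∀ {x y} → project x ≡ project y → fibre x ≡ fibre y → x ≡ y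
  project-fibre-injective {x} {y} px≡py fx≡fy = begin
    x                              ≡⟨ combine-remQuot {n} K x ⟨
    combine (project x) (fibre x)  ≡⟨ cong₂ combine px≡py fx≡fy ⟩
    combine (project y) (fibre y)  ≡⟨ combine-remQuot {n} K y ⟩
    y                              ∎
    where open ≡-Reasoning

  lift-adj⇒adj : ∀ {x y} → liftAdj x y ≡ true → adj G (project x) (project y) ≡ true
  lift-adj⇒adj {x} {y} = ∧-conicalˡ _ (does (fibre y ≟ π (project x) (project y) (fibre x)))

  lift-adj⇒fibre : ∀ {x y} → liftAdj x y ≡ true → fibre y ≡ π (project x) (project y) (fibre x)
  lift-adj⇒fibre {x} {y} e
    with fibre y ≟ π (project x) (project y) (fibre x) | ∧-conicalʳ (adj G (project x) (project y)) _ e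
  ... | yes fy≡ | _  = fy≡
  ... | no _    | ()

  sum-fibre : ∀ a b (t : Fin K) → ∑[ s < K ] indicator ((a ∧ does (s ≟ t)) ∧ b) ≡ indicator (a ∧ b)
  sum-fibre a b t = trans (sum-pointMass f t off-t) at-t
    where
    f : Fin K → ℕ
    f s = indicator ((a ∧ does (s ≟ t)) ∧ b)

    off-t : ∀ s → s ≢ t → f s ≡ 0
    off-t s s≢t = trans (cong (λ c → indicator ((a ∧ c) ∧ b)) (dec-false (s ≟ t) s≢t))
                        (cong (λ c → indicator (c ∧ b)) (∧-zeroʳ a))

    at-t : f t ≡ indicator (a ∧ b)
    at-t = trans (cong (λ c → indicator ((a ∧ c) ∧ b)) (dec-true (t ≟ t) refl))
                 (cong (λ c → indicator (c ∧ b)) (∧-identityʳ a))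

  degIn-lift : ∀ x (P : Fin n → Bool) → degIn lift x (P ∘ project) ≡ degIn G (project x) P
  degIn-lift x P = begin
    degIn lift x (P ∘ project)
      ≡⟨ degIn≡count lift x (P ∘ project) ⟩
    count (λ y → liftAdj x y ∧ P (project y))
      ≡⟨ sum-combine n K _ ⟩
    ∑[ w < n ] ∑[ s < K ] indicator (liftAdj x (combine w s) ∧ P (project (combine w s)))
      ≡⟨ sum-cong-≗ (λ w → sum-cong-≗ (λ s → cong (λ (v , r) → indicator
           ((adj G u v ∧ does (r ≟ π u v (fibre x))) ∧ P v)) (remQuot-combine {n} {K} w s))) ⟩
    ∑[ w < n ] ∑[ s < K ] indicator ((adj G u w ∧ does (s ≟ π u w (fibre x))) ∧ P w)
      ≡⟨ sum-cong-≗ (λ w → sum-fibre (adj G u w) (P w) (π u w (fibre x))) ⟩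
    count (λ w → adj G u w ∧ P w)
      ≡⟨ degIn≡count G u P ⟨
    degIn G u P
      ∎
    where
    open ≡-Reasoning
    u : Fin n
    u = project x

  lift-isCoveringMap : Fin K → IsCoveringMap lift G project
  lift-isCoveringMap s = record
    { adj-preserving   = lift-adj⇒adj
    ; degIn-preserving = degIn-lift
    ; surjective       = λ v → combine v s , project-combine v s
    }

  module _ {m} {f : Fin (suc m) → Fin (n * K)} (walk : IsWalk lift f) where

    projection-isWalk : IsWalk G (project ∘ f)
    projection-isWalk x y 1+x≡y = lift-adj⇒adj (walk x y 1+x≡y)

    projection-isNonBacktracking : Injective _≡_ _≡_ f → IsNonBacktracking G (project ∘ f)
    projection-isNonBacktracking f-inj x (fsuc y) 2+x≡1+y px≡py =
      ℕ.<⇒≢ (ℕ.m<n+m (toℕ x) (s≤s z≤n))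
        (trans (cong toℕ (f-inj (project-fibre-injective px≡py same-fibre))) (sym 2+x≡1+y))
      where
      p : Fin (suc m) → Fin n
      p = project ∘ f
      z : Fin (suc m)
      z = inject₁ y

      into-z : fibre (f z) ≡ π (p x) (p z) (fibre (f x))
      into-z = lift-adj⇒fibre (walk x z (trans (ℕ.suc-injective 2+x≡1+y) (sym (toℕ-inject₁ y))))

      out-of-z : fibre (f (fsuc y)) ≡ π (p z) (p (fsuc y)) (fibre (f z))
      out-of-z = lift-adj⇒fibre (walk z (fsuc y) (cong suc (toℕ-inject₁ y)))

      same-fibre : fibre (f x) ≡ fibre (f (fsuc y))
      same-fibre = begin
        fibre (f x)                                  ≡⟨ π-inverse (p x) (p z) (fibre (f x)) ⟨
        π (p z) (p x) (π (p x) (p z) (fibre (f x)))  ≡⟨ cong₂ (π (p z)) px≡py (sym into-z) ⟩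
        π (p z) (p (fsuc y)) (fibre (f z))           ≡⟨ out-of-z ⟨
        fibre (f (fsuc y))                           ∎
        where open ≡-Reasoning

  CyclesProjectNonInjectively : Set
  CyclesProjectNonInjectively = ∀ {m} (f : Fin (suc m) → Fin (n * K)) → 3 ≤ suc m →
    (∀ (j : Fin m) → liftAdj (f (inject₁ j)) (f (fsuc j)) ≡ true) →
    liftAdj (f (fromℕ m)) (f fzero) ≡ true → ¬ Injective _≡_ _≡_ (project ∘ f)

  lift-girth : ∀ {g} → CyclesProjectNonInjectively →
               GirthGreaterThan G g → GirthGreaterThan lift (suc g)
  lift-girth nonInjective girth (suc m) (3≤1+m , f , f-inj , steps , closes)
    with injective⊎firstRepetition (project ∘ f)
  ... | inj₁ p-inj = ⊥-elim (nonInjective f 3≤1+m steps closes p-inj)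
  ... | inj₂ repetition
    with firstRepetition⇒shorterCycle G (projection-isWalk (cycle-isWalk lift f steps))
           (projection-isNonBacktracking (cycle-isWalk lift f steps) f-inj) repetition
  ...   | d , d<1+m , cycle = ℕ.≤-trans (s≤s (girth d cycle)) d<1+m

module HomologyCover {n : ℕ} (G : Graph n) where

  π : Fin n → Fin n → Bits (n * n) → Bits (n * n)
  π u v = flip (combine u v) ∘ flip (combine v u)

  π-inverse : ∀ u v s → π v u (π u v s) ≡ s
  π-inverse u v s = trans (cong (flip (combine v u)) (flip-involutive (combine u v) _))
                          (flip-involutive (combine v u) s)

  open PermutationLift G π π-inverse public

  cyclesProjectNonInjectively : CyclesProjectNonInjectively
  cyclesProjectNonInjectively {m} f 3≤1+m steps closes p-inj =
    opposite-≢ (h fzero) (sym (begin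
      h fzero                                   ≡⟨ cong (bit c) (lift-adj⇒fibre closes) ⟩
      bit c (flip c (flip c′ (s (fromℕ m))))    ≡⟨ bit-flip c _ ⟩
      opposite (bit c (flip c′ (s (fromℕ m))))  ≡⟨ cong opposite (bit-flip-≢ c c′ _ c≢c′) ⟩
      opposite (h (fromℕ m))                    ≡⟨ cong opposite (constant-along h h-step (fromℕ m)) ⟩
      opposite (h fzero)                        ∎))
    where
    open ≡-Reasoning
    p : Fin (suc m) → Fin n
    p = project ∘ f
    s : Fin (suc m) → Bits (n * n)
    s = fibre ∘ f

    -- Only the closing edge toggles c: the other edges of the cycle join different pairs.
    c c′ : Fin (n * n)
    c  = combine (p (fromℕ m)) (p fzero)
    c′ = combine (p fzero) (p (fromℕ m))

    h : Fin (suc m) → Fin 2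
    h x = bit c (s x)

    toℕ-p : ∀ {x y} → p x ≡ p y → toℕ x ≡ toℕ y
    toℕ-p = cong toℕ ∘ p-inj

    pairs : ∀ {a b a′ b′ : Fin n} → combine a b ≡ combine a′ b′ → a ≡ a′ × b ≡ b′
    pairs = combine-injective _ _ _ _

    m≥2 : 2 ≤ m
    m≥2 = s≤s⁻¹ 3≤1+m

    is-last : ∀ {x} → p (fromℕ m) ≡ p x → m ≡ toℕ x
    is-last eq = trans (sym (toℕ-fromℕ m)) (toℕ-p eq)

    c≢c′ : c ≢ c′
    c≢c′ eq with () ← subst (2 ≤_) (is-last (proj₁ (pairs eq))) m≥2

    c≢forward : ∀ (j : Fin m) → c ≢ combine (p (inject₁ j)) (p (fsuc j))
    c≢forward j eq = toℕ-inject₁-≢ j (is-last (proj₁ (pairs eq)))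

    c≢backward : ∀ (j : Fin m) → c ≢ combine (p (fsuc j)) (p (inject₁ j))
    c≢backward j eq = ℕ.1+n≰n (subst (2 ≤_) m≡1 m≥2)
      where
      m≡1 : m ≡ 1
      m≡1 = trans (is-last (proj₁ (pairs eq)))
                  (cong suc (trans (sym (toℕ-inject₁ j)) (toℕ-p (sym (proj₂ (pairs eq))))))

    h-step : ∀ (j : Fin m) → h (fsuc j) ≡ h (inject₁ j)
    h-step j = trans (cong (bit c) (lift-adj⇒fibre (steps j)))
                     (trans (bit-flip-≢ c _ _ (c≢forward j)) (bit-flip-≢ c _ _ (c≢backward j)))

  homologyCover-isCoveringMap : IsCoveringMap lift G project
  homologyCover-isCoveringMap = lift-isCoveringMap (fromℕ< (ℕ.m^n>0 2 (n * n)))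

  homologyCover-girth : ∀ {g} → GirthGreaterThan G g → GirthGreaterThan lift (suc g)
  homologyCover-girth = lift-girth cyclesProjectNonInjectively

-- The base graph

suc-toℕ-pred : ∀ {t} (i : Fin t) → 1 ≤ toℕ i → suc (toℕ (pred i)) ≡ toℕ i
suc-toℕ-pred (fsuc i) _ = cong suc (toℕ-inject₁ i)

-- Vertex combine i 0 is ℓ_i and combine i (k + 1) is r_ik; ℓ_i is linked to the right
-- vertices of layers i and i - 1.
module BaseGraph (C t : ℕ) where

  layer : Fin (t * suc C) → Fin t
  layer v = proj₁ (remQuot {t} (suc C) v)

  slot : Fin (t * suc C) → Fin (suc C)
  slot v = proj₂ (remQuot {t} (suc C) v)

  sideOfSlot : Fin (suc C) → Side
  sideOfSlot fzero    = L
  sideOfSlot (fsuc _) = R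

  side : Fin (t * suc C) → Side
  side = sideOfSlot ∘ slot

  linked : Fin t → Fin t → Bool
  linked i j = (toℕ i ≡ᵇ toℕ j) ∨ (toℕ i ≡ᵇ suc (toℕ j))

  slotAdj : Fin t → Fin (suc C) → Fin t → Fin (suc C) → Bool
  slotAdj i fzero    j fzero    = false
  slotAdj i fzero    j (fsuc _) = linked i j
  slotAdj i (fsuc _) j fzero    = linked j i
  slotAdj i (fsuc _) j (fsuc _) = false

  slotAdj-sym : ∀ i k j l → slotAdj i k j l ≡ slotAdj j l i k
  slotAdj-sym i fzero    j fzero    = refl
  slotAdj-sym i fzero    j (fsuc _) = refl
  slotAdj-sym i (fsuc _) j fzero    = refl
  slotAdj-sym i (fsuc _) j (fsuc _) = refl

  slotAdj-irrefl : ∀ i k → slotAdj i k i k ≡ false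
  slotAdj-irrefl i fzero    = refl
  slotAdj-irrefl i (fsuc _) = refl

  base : Graph (t * suc C)
  base = record
    { adj    = λ u v → slotAdj (layer u) (slot u) (layer v) (slot v)
    ; sym    = λ u v → slotAdj-sym (layer u) (slot u) (layer v) (slot v)
    ; irrefl = λ v → slotAdj-irrefl (layer v) (slot v)
    }

  linked⇒allowed : ∀ i j → linked i j ≡ true → AllowedEdge L i R j ⊎ AllowedEdge R j L i
  linked⇒allowed i j e = Sum.map (ℕ.≡ᵇ⇒≡ _ _) (sym ∘ ℕ.≡ᵇ⇒≡ _ _)
    (Equivalence.to T-∨ (Equivalence.from T-≡ e))

  slotAdj⇒allowed : ∀ i k j l → slotAdj i k j l ≡ true →
                    AllowedEdge (sideOfSlot k) i (sideOfSlot l) j ⊎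
                    AllowedEdge (sideOfSlot l) j (sideOfSlot k) i
  slotAdj⇒allowed i fzero    j (fsuc _) e = linked⇒allowed i j e
  slotAdj⇒allowed i (fsuc _) j fzero    e = Sum.swap (linked⇒allowed j i e)

  linked-refl : ∀ i → linked i i ≡ true
  linked-refl i = cong (_∨ (toℕ i ≡ᵇ suc (toℕ i))) (dec-true (toℕ i ℕ.≟ toℕ i) refl)

  linked-suc : ∀ i j → suc (toℕ j) ≡ toℕ i → linked i j ≡ true
  linked-suc i j 1+j≡i =
    trans (cong ((toℕ i ≡ᵇ toℕ j) ∨_) (dec-true (toℕ i ℕ.≟ suc (toℕ j)) (sym 1+j≡i))) (∨-zeroʳ _)

  slotDegree : Fin t → Fin (suc C) → (Side → Fin t → Bool) → ℕ
  slotDegree i k Q = ∑[ j < t ] ∑[ l < suc C ] indicator (slotAdj i k j l ∧ Q (sideOfSlot l) j)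

  degIn-base : ∀ v Q → degIn base v (λ w → Q (side w) (layer w)) ≡ slotDegree (layer v) (slot v) Q
  degIn-base v Q = trans (degIn≡count base v _) (trans (sum-combine t (suc C) _)
    (sum-cong-≗ (λ j → sum-cong-≗ (λ l →
      cong (λ (i , k) → indicator (slotAdj (layer v) (slot v) i k ∧ Q (sideOfSlot k) i))
           (remQuot-combine {t} {suc C} j l)))))

  slotDegree-L : ∀ i Q → slotDegree i fzero Q ≡ C * count (λ j → linked i j ∧ Q R j)
  slotDegree-L i Q = trans (sum-cong-≗ (λ j → sum-const C (b j))) (sym (*-distribˡ-sum C b))
    where
    b : Fin t → ℕ
    b j = indicator (linked i j ∧ Q R j)

  slotDegree-R : ∀ i k Q → slotDegree i (fsuc k) Q ≡ count (λ j → linked j i ∧ Q L j)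
  slotDegree-R i k Q = sum-cong-≗ λ j →
    trans (cong (indicator (linked j i ∧ Q L j) +_) (sum-zero {C} (λ _ → 0) (λ _ → refl)))
          (ℕ.+-identityʳ _)

  sameLayer nextPair previousPair : Fin t → Side → Fin t → Bool
  sameLayer    i _ j = toℕ j ≡ᵇ toℕ i
  nextPair     i s j = (isR s ∧ (toℕ j ≡ᵇ toℕ i)) ∨ (isL s ∧ (toℕ j ≡ᵇ suc (toℕ i)))
  previousPair i s j = (isR s ∧ (suc (toℕ j) ≡ᵇ toℕ i)) ∨ (isL s ∧ (toℕ j ≡ᵇ toℕ i))

  blockL-slot : ∀ i k → sideOfSlot k ≡ L → slotDegree i k (sameLayer i) ≡ C
  blockL-slot i fzero _ = begin
    slotDegree i fzero (sameLayer i)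
      ≡⟨ slotDegree-L i (sameLayer i) ⟩
    C * count (λ j → linked i j ∧ (toℕ j ≡ᵇ toℕ i))
      ≡⟨ cong (C *_) (count-pinned (linked i) i refl (linked-refl i)) ⟩
    C * 1
      ≡⟨ ℕ.*-identityʳ C ⟩
    C ∎
    where open ≡-Reasoning

  blockR-slot : ∀ i k → sideOfSlot k ≡ R → slotDegree i k (sameLayer i) ≡ 1
  blockR-slot i (fsuc k) _ =
    trans (slotDegree-R i k (sameLayer i)) (count-pinned (λ j → linked j i) i refl (linked-refl i))

  linkR-slot : ∀ i k → sideOfSlot k ≡ R → suc (toℕ i) < t → slotDegree i k (nextPair i) ≡ 1
  linkR-slot i (fsuc k) _ 1+i<t = trans (slotDegree-R i k (nextPair i))
    (count-pinned (λ j → linked j i) next (toℕ-fromℕ< 1+i<t)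
                  (linked-suc next i (sym (toℕ-fromℕ< 1+i<t))))
    where
    next : Fin t
    next = fromℕ< 1+i<t

  linkL-slot : ∀ i k → sideOfSlot k ≡ L → 1 ≤ toℕ i → slotDegree i k (previousPair i) ≡ C
  linkL-slot i fzero _ 1≤i = begin
    slotDegree i fzero (previousPair i)
      ≡⟨ slotDegree-L i (previousPair i) ⟩
    C * count (λ j → linked i j ∧ ((suc (toℕ j) ≡ᵇ toℕ i) ∨ false))
      ≡⟨ cong (C *_) (sum-cong-≗ λ j → cong (λ b → indicator (linked i j ∧ b)) (precedes j)) ⟩
    C * count (λ j → linked i j ∧ (toℕ j ≡ᵇ toℕ (pred i)))
      ≡⟨ cong (C *_) (count-pinned (linked i) (pred i) refl
                                   (linked-suc i (pred i) (suc-toℕ-pred i 1≤i))) ⟩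
    C * 1
      ≡⟨ ℕ.*-identityʳ C ⟩
    C ∎
    where
    open ≡-Reasoning
    precedes : ∀ j → ((suc (toℕ j) ≡ᵇ toℕ i) ∨ false) ≡ (toℕ j ≡ᵇ toℕ (pred i))
    precedes j = trans (∨-identityʳ _) (cong (suc (toℕ j) ≡ᵇ_) (sym (suc-toℕ-pred i 1≤i)))

  base-isLayered : 0 < C → IsLayered C t base side layer
  base-isLayered 0<C = record
    { nonempty = nonempty
    ; edges    = λ u v → slotAdj⇒allowed (layer u) (slot u) (layer v) (slot v)
    ; blockL   = λ v sv → trans (degIn-base v (sameLayer (layer v)))
                                (blockL-slot (layer v) (slot v) sv)
    ; blockR   = λ v sv → trans (degIn-base v (sameLayer (layer v)))
                                (blockR-slot (layer v) (slot v) sv)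
    ; linkR    = λ v sv last → trans (degIn-base v (nextPair (layer v)))
                                     (linkR-slot (layer v) (slot v) sv last)
    ; linkL    = λ v sv first → trans (degIn-base v (previousPair (layer v)))
                                      (linkL-slot (layer v) (slot v) sv first)
    }
    where
    at : ∀ i k → side (combine i k) ≡ sideOfSlot k × layer (combine i k) ≡ i
    at i k = cong (sideOfSlot ∘ proj₂) (remQuot-combine i k) , cong proj₁ (remQuot-combine i k)

    nonempty : ∀ s i → ∃[ v ] (side v ≡ s × layer v ≡ i)
    nonempty L i = combine i fzero , at i fzero
    nonempty R i = combine i (fsuc (fromℕ< 0<C)) , at i (fsuc (fromℕ< 0<C))

-- Raising the girth

girth>0 : ∀ {n} (G : Graph n) → GirthGreaterThan G 0
girth>0 G (suc _) _ = s≤s z≤n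

record LayeredGraphOfGirth> (C t g : ℕ) : Set where
  field
    size      : ℕ
    graph     : Graph size
    side      : Fin size → Side
    layer     : Fin size → Fin t
    isLayered : IsLayered C t graph side layer
    girth     : GirthGreaterThan graph g

layeredGraphOfGirth> : ∀ {C} t g → 0 < C → LayeredGraphOfGirth> C t g
layeredGraphOfGirth> {C} t zero 0<C = record
  { graph     = base
  ; side      = side
  ; layer     = layer
  ; isLayered = base-isLayered 0<C
  ; girth     = girth>0 base
  }
  where open BaseGraph C t
layeredGraphOfGirth> t (suc g) 0<C = record
  { graph     = lift
  ; side      = side ∘ project
  ; layer     = layer ∘ project
  ; isLayered = IsLayered-pullback homologyCover-isCoveringMap isLayered
  ; girth     = homologyCover-girth girth
  }
  where
  open LayeredGraphOfGirth> (layeredGraphOfGirth> t g 0<C)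
  open HomologyCover graph

lemma3 : ∀ (C ρ t : ℕ) → 2 ≤ C → 1 ≤ ρ → 1 ≤ t →
    ∃[ n ] Σ (Graph n) λ G → Σ (Fin n → Side) λ side → Σ (Fin n → Fin t) λ idx →
      Σ (IsLayered C t G side idx) λ _ → GirthGreaterThan G (2 * t * ρ)
lemma3 C ρ t 2≤C _ _ = size , graph , side , layer , isLayered , girth
  where
  open LayeredGraphOfGirth> (layeredGraphOfGirth> t (2 * t * ρ) (ℕ.≤-trans (s≤s z≤n) 2≤C))
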